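{- Every unsatisfiable orderable string constraint admits a closed proof in the RCP proof system using only the rules Close, Intersect, Fwd-Prop and Bwd-Prop.
   Context: Fix a finite alphabet $\Sigma$; string variables take values in $\Sigma^*$. A string constraint is a finite conjunction (equivalently a finite set, called a sequent) of regular constraints $x\in e$ ($e$ a regular expression with language $L(e)$) and equational constraints $x=f(x_1,\dots,x_n)$ with $f:(\Sigma^*)^n\to\Sigma^*$ a string function. It is satisfiable if some assignment of strings to its variables satisfies every conjunct. A function $f$ is forwardable if for all regular $L_1,\dots,L_n$ the image $f(L_1,\dots,L_n)$ is regular and computable from the $L_i$; $f$ is backwardable if for every regular $L$ the preimage $f^{ -1}(L)$ equals a finite union $\bigcup_{i=1}^k L_{i,1}\times\dots\times L_{i,n}$ of products of regular languages, computable from $L$. RCP proof system: proof trees of sequents with the root at the bottom; a node has as children the premises of the rule applied to it. Rules: Close: a sequent $\Gamma, x\in e_1,\dots,x\in e_n$ with $L(e_1)\cap\dots\cap L(e_n)=\emptyset$ needs no premise (closed leaf). Intersect: $\Gamma, x\in e_1,\dots,x\in e_n$ has premise $\Gamma, x\in e$ with $L(e)=\bigcap_i L(e_i)$. Fwd-Prop: $\Gamma, x_1\in e_1,\dots,x_n\in e_n, x=f(x_1,\dots,x_n)$ has premise $\Gamma, x\in e, x=f(x_1,\dots,x_n), x_1\in e_1,\dots,x_n\in e_n$ with $L(e)=f(L(e_1),\dots,L(e_n))$. Bwd-Prop: $\Gamma, x\in e, x=f(x_1,\dots,x_n)$ has the premises $\Gamma, x\in e, x=f(x_1,\dots,x_n),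 x_1\in e^i_1,\dots,x_n\in e^i_n$, $i=1,\dots,k$, where $f^{ -1}(L(e))=\bigcup_{i=1}^k L(e^i_1)\times\dots\times L(e^i_n)$. A proof is closed if every leaf is closed by Close. Marking Algorithm on a finite set $Eqs$ of equational constraints: remaining $:=Eqs$, marked $:=\emptyset$, flow $:=$ empty. Repeat rounds until marked is unchanged by a round; a round: (a) add to marked every variable with exactly one occurrence (with multiplicity, either side) in remaining; (b) for each $\phi=(x=f(y_1,\dots,y_k))$ in remaining in turn: if $x\in$ marked and $f$ backwardable, append $(\phi,\rightarrow)$ and remove $\phi$; else if $y_1,\dots,y_k\in$ marked and $f$ forwardable, append $(\phi,\leftarrow)$ and remove $\phi$. Output flow if remaining is empty, otherwise $\bot$. A string constraint is orderable if on its set of equational constraints the algorithm outputs a flow sequence (not $\bot$). -}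

module Defs where

open import Data.Nat using (ℕ; zero; suc; _+_; _≡ᵇ_)
open import Data.Nat.Properties using (_≟_)
open import Data.Fin using (Fin)
open import Data.Bool using (Bool; true; false; if_then_else_; _∧_)
open import Data.List using (List; []; _∷_; _++_; map; length; concatMap; null)
open import Data.List.Membership.Propositional using (_∈_)
open import Data.List.Membership.DecPropositional _≟_ using (_∈?_)
open import Data.List.Relation.Unary.All using (All)
open import Data.List.Relation.Unary.Any using (Any)
open import Data.Vec using (Vec; []; _∷_; toList) renaming (map to vmap)
open import Data.Product using (Σ; ∃; _×_; _,_)
open import Data.Maybe using (Maybe; just; nothing)
open import Function.Bundles using (_⇔_)
open import Relation.Nullary using (Dec; does; ¬_)
open import Relation.Binary.PropositionalEquality using (_≡_)

Str : ℕ → Set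
Str k = List (Fin k)

data Regex (k : ℕ) : Set where
  ∅ε      : Regex k
  ε       : Regex k
  chr     : Fin k → Regex k
  _∣_     : Regex k → Regex k → Regex k
  _·_     : Regex k → Regex k → Regex k
  _⋆      : Regex k → Regex k

data _∈L_ {k : ℕ} : Str k → Regex k → Set where
  ε∈   : [] ∈L ε
  chr∈ : ∀ a → (a ∷ []) ∈L chr a
  ∣ˡ   : ∀ {w e f} → w ∈L e → w ∈L (e ∣ f)
  ∣ʳ   : ∀ {w e f} → w ∈L f → w ∈L (e ∣ f)
  ·∈   : ∀ {u v e f} → u ∈L e → v ∈L f → (u ++ v) ∈L (e · f)
  ⋆ε   : ∀ {e} → [] ∈L (e ⋆)
  ⋆∷   : ∀ {u v e} → u ∈L e → v ∈L (e ⋆) → (u ++ v) ∈L (e ⋆)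

_∈Lᵛ_ : ∀ {k n} → Vec (Str k) n → Vec (Regex k) n → Set
[] ∈Lᵛ [] = Data.Unit.⊤ where import Data.Unit
(w ∷ ws) ∈Lᵛ (e ∷ es) = (w ∈L e) × (ws ∈Lᵛ es)

-- Forwardable / backwardable string functions
-- ("computable" is rendered constructively: the regular expressions are
--  produced by a function of the input regular expressions)

Forwardable : ∀ {k n} → (Vec (Str k) n → Str k) → Set
Forwardable {k} {n} f =
  (es : Vec (Regex k) n) → Σ (Regex k) λ e →
    ∀ w → (w ∈L e) ⇔ (∃ λ ws → (ws ∈Lᵛ es) × f ws ≡ w)

Backwardable : ∀ {k n} → (Vec (Str k) n → Str k) → Set
Backwardable {k} {n} f =
  (e : Regex k) → Σ (List (Vec (Regex k) n)) λ ts →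
    ∀ ws → (f ws ∈L e) ⇔ Any (ws ∈Lᵛ_) ts

-- A string function symbol: its arity, its semantics, and the (decided)
-- information whether it is forwardable / backwardable, which the
-- marking algorithm branches on.
record StrFun (k : ℕ) : Set where
  field
    arity : ℕ
    fun   : Vec (Str k) arity → Str k
    fwd?  : Dec (Forwardable fun)
    bwd?  : Dec (Backwardable fun)
open StrFun public

Var : Set
Var = ℕ

record Eqn (k : ℕ) : Set where
  constructor _≐_⟨_⟩
  field
    lhs  : Var
    fn   : StrFun k
    args : Vec Var (arity fn)
open Eqn public

data Constraint (k : ℕ) : Set where
  _∈ʳ_ : Var → Regex k → Constraint k
  eqn  : Eqn k → Constraint k

Sequent : ℕ → Set
Sequent k = List (Constraint k)

Sat : ∀ {k} → (Var → Str k) → Constraint k → Set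
Sat ρ (x ∈ʳ e) = ρ x ∈L e
Sat ρ (eqn (x ≐ F ⟨ ys ⟩)) = ρ x ≡ fun F (vmap ρ ys)

Satisfiable : ∀ {k} → Sequent k → Set
Satisfiable {k} S = Σ (Var → Str k) λ ρ → All (Sat ρ) S

-- RCP proof system (sequents are finite sets: compared up to membership)

_≈ˢ_ : ∀ {k} → Sequent k → Sequent k → Set
S ≈ˢ T = ∀ c → (c ∈ S) ⇔ (c ∈ T)

regs : ∀ {k} → Var → List (Regex k) → Sequent k
regs x es = map (x ∈ʳ_) es

regsᵛ : ∀ {k n} → Vec Var n → Vec (Regex k) n → Sequent k
regsᵛ [] [] = []
regsᵛ (x ∷ xs) (e ∷ es) = (x ∈ʳ e) ∷ regsᵛ xs es

-- RCP S : a closed RCP proof of sequent S using Close, Intersect,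
-- Fwd-Prop, Bwd-Prop (every leaf is a Close leaf, since Close is the only
-- premise-free rule and Bwd-Prop is required to have ≥ 1 premise).
data RCP {k : ℕ} : Sequent k → Set where
  close : ∀ {S} (Γ : Sequent k) (x : Var) (es : List (Regex k)) →
    S ≈ˢ (Γ ++ regs x es) →
    (∀ w → ¬ All (w ∈L_) es) →
    RCP S
  intersect : ∀ {S} (Γ : Sequent k) (x : Var) (es : List (Regex k)) (e : Regex k) →
    S ≈ˢ (Γ ++ regs x es) →
    (∀ w → (w ∈L e) ⇔ All (w ∈L_) es) →
    RCP (Γ ++ (x ∈ʳ e) ∷ []) →
    RCP S
  fwd-prop : ∀ {S} (Γ : Sequent k) (E : Eqn k) (es : Vec (Regex k) (arity (fn E))) (e : Regex k) →
    S ≈ˢ (Γ ++ regsᵛ (args E) es ++ eqn E ∷ []) →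
    (∀ w → (w ∈L e) ⇔ (∃ λ ws → (ws ∈Lᵛ es) × fun (fn E) ws ≡ w)) →
    RCP (Γ ++ (lhs E ∈ʳ e) ∷ eqn E ∷ regsᵛ (args E) es) →
    RCP S
  bwd-prop : ∀ {S} (Γ : Sequent k) (E : Eqn k) (e : Regex k)
    (t : Vec (Regex k) (arity (fn E))) (ts : List (Vec (Regex k) (arity (fn E)))) →
    S ≈ˢ (Γ ++ (lhs E ∈ʳ e) ∷ eqn E ∷ []) →
    (∀ ws → (fun (fn E) ws ∈L e) ⇔ Any (ws ∈Lᵛ_) (t ∷ ts)) →
    All (λ tᵢ → RCP (Γ ++ (lhs E ∈ʳ e) ∷ eqn E ∷ regsᵛ (args E) tᵢ)) (t ∷ ts) →
    RCP S

data Dir : Set where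
  ⟶ ⟵ : Dir

Flow : ℕ → Set
Flow k = List (Eqn k × Dir)

eqVars : ∀ {k} → Eqn k → List Var
eqVars E = lhs E ∷ toList (args E)

allVars : ∀ {k} → List (Eqn k) → List Var
allVars = concatMap eqVars

countIn : Var → List Var → ℕ
countIn v [] = 0
countIn v (y ∷ ys) = (if does (v ≟ y) then 1 else 0) + countIn v ys

occ : ∀ {k} → List (Eqn k) → Var → ℕ
occ Eqs v = countIn v (allVars Eqs)

addMarks : List Var → List Var → List Var
addMarks M [] = M
addMarks M (v ∷ vs) = if does (v ∈? M) then addMarks M vs else addMarks (M ++ v ∷ []) vs

stepA : ∀ {k} → List (Eqn k) → List Var → List Var
stepA rem M = addMarks M (Data.List.filter (λ v → occ rem v ≟ 1) (allVars rem))

allB : List Bool → Bool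
allB [] = true
allB (b ∷ bs) = b ∧ allB bs

marked? : List Var → Var → Bool
marked? M v = does (v ∈? M)

stepB : ∀ {k} → List Var → List (Eqn k) → Flow k × List (Eqn k)
stepB M [] = [] , []
stepB M (E ∷ Es) with stepB M Es
... | fl , rest =
  if marked? M (lhs E) ∧ does (bwd? (fn E)) then ((E , ⟶) ∷ fl , rest)
  else if allB (map (marked? M) (toList (args E))) ∧ does (fwd? (fn E)) then ((E , ⟵) ∷ fl , rest)
  else (fl , E ∷ rest)

record MState (k : ℕ) : Set where
  constructor mstate
  field
    remaining : List (Eqn k)
    marked    : List Var
    flow      : Flow k

round : ∀ {k} → MState k → MState k
round (mstate rem M fl) with stepA rem M
... | M′ with stepB M′ rem
...   | fl′ , rem′ = mstate rem′ M′ (fl ++ fl′)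

-- fuel-bounded iteration; the fuel used below (1 + number of variable
-- occurrences) always suffices, as marked grows strictly in every
-- non-final round and only contains variables of Eqs.
runRounds : ∀ {k} → ℕ → MState k → Maybe (Flow k)
runRounds zero st = nothing
runRounds (suc n) st with round st
... | st′@(mstate rem′ M′ fl′) =
  if length M′ ≡ᵇ length (MState.marked st)
  then (if null rem′ then just fl′ else nothing)
  else runRounds n st′

markingAlgorithm : ∀ {k} → List (Eqn k) → Maybe (Flow k)
markingAlgorithm Eqs = runRounds (suc (length (allVars Eqs))) (mstate Eqs [] [])

eqsOf : ∀ {k} → Sequent k → List (Eqn k)
eqsOf [] = []
eqsOf ((x ∈ʳ e) ∷ S) = eqsOf S
eqsOf (eqn E ∷ S) = E ∷ eqsOf S

Orderable : ∀ {k} → Sequent k → Set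
Orderable {k} S = Σ (Flow k) λ fl → markingAlgorithm (eqsOf S) ≡ just fl

-- Follow the removal order computed by the marking algorithm. When an equation x = f(ys) is
-- removed backwards, x occurs in no later equation: intersect the constraints on x and apply
-- Bwd-Prop to the preimage; a model of any branch extends to a model of the equation by
-- redefining x as f(ys). When it is removed forwards, the ys are distinct and occur in no later
-- equation: intersect their constraints and apply Fwd-Prop; a model extends by redefining the ys
-- as a preimage of x. Either way the regular constraints together with the remaining equations
-- stay unsatisfiable, so once no equation remains some variable has regular constraints with
-- empty intersection, and Close applies. Intersections of regular expressions are obtained by
-- state elimination on the product of the partial-derivative automata.

module Submission where

open import Defs
open import Data.Nat as ℕ using (ℕ; zero; suc; _+_; _≤_; z≤n; s≤s; _≡ᵇ_)
open import Data.Nat.Properties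
  using (+-assoc; +-mono-≤; m≤m+n; m≤n+m; ≤-trans; ≤-reflexive; <-irrefl; module ≤-Reasoning)
open import Data.Nat.ListAction using (sum)
open import Data.Nat.ListAction.Properties using (sum-↭)
open import Data.Fin using (Fin)
import Data.Fin.Properties as Fin
open import Data.Bool using (true; false; if_then_else_; _∧_)
open import Data.List
  using (List; []; _∷_; [_]; _++_; map; foldr; length; null; allFin; cartesianProduct)
open import Data.List.Properties
  using (++-assoc; ++-identityʳ; ++-conicalˡ; ++-conicalʳ; map-++; concatMap-++)
open import Data.List.Membership.Propositional using (_∈_; _∉_; find; lose)
open import Data.List.Membership.Propositional.Properties
  using (∈-map⁺; ∈-map⁻; ∈-++⁺ˡ; ∈-++⁺ʳ; ∈-++⁻; ∈-allFin; ∈-cartesianProduct⁺; ∈-filter⁻)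
open import Data.List.Membership.DecPropositional ℕ._≟_ using (_∈?_)
open import Data.List.Relation.Binary.Disjoint.Propositional using (Disjoint)
open import Data.List.Relation.Binary.Permutation.Propositional
  using (_↭_; ↭-sym; ↭-refl; ↭-prep; ↭-trans; module PermutationReasoning)
import Data.List.Relation.Binary.Permutation.Propositional.Properties as ↭
open import Data.List.Relation.Binary.Subset.Propositional using (_⊆_)
open import Data.List.Relation.Binary.Subset.Propositional.Properties
  using (⊆-refl; ⊆-reflexive; xs⊆xs++ys; ++⁺)
open import Data.List.Relation.Unary.All using (All; []; _∷_)
import Data.List.Relation.Unary.All as All
open import Data.List.Relation.Unary.All.Properties using (¬Any⇒All¬)
open import Data.List.Relation.Unary.AllPairs using ([]; _∷_)
open import Data.List.Relation.Unary.Any using (Any; here; there; any?)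
import Data.List.Relation.Unary.Any as Any
import Data.List.Relation.Unary.Any.Properties as Anyₚ
open import Data.List.Relation.Unary.Unique.Propositional using (Unique)
open import Data.Vec using (Vec; []; _∷_; toList; replicate) renaming (map to vmap; head to vhead)
open import Data.Maybe using (just; nothing)
open import Data.Product using (Σ; ∃; ∃₂; _×_; _,_; proj₁; proj₂; uncurry; map₂)
open import Data.Sum using (_⊎_; inj₁; inj₂; [_,_]′)
import Data.Sum as Sum
open import Data.Empty using (⊥; ⊥-elim)
open import Data.Unit using (tt)
open import Function using (_∘_; id)
open import Function.Bundles using (_⇔_; mk⇔; Equivalence)
import Function.Properties.Equivalence as ⇔
open import Relation.Nullary using (Dec; yes; no; does; ¬_; ¬?)
open import Relation.Nullary.Decidable using (map′; _×-dec_; _⊎-dec_; dec-true)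
open import Relation.Unary using (Decidable)
open import Relation.Binary.Definitions using (DecidableEquality)
open import Relation.Binary.PropositionalEquality
  using (_≡_; _≢_; refl; sym; trans; cong; cong₂; subst; module ≡-Reasoning)

open Equivalence using (to; from)

private
  variable
    k n : ℕ
    e f : Regex k
    w : Str k
    v x : Var
    xs ys : List Var
    Es : List (Eqn k)
    R T U : Sequent k
    ρ : Var → Str k

shape : Regex k → ℕ
shape ∅ε      = 0
shape ε       = 1
shape (chr _) = 2
shape (_ ∣ _) = 3
shape (_ · _) = 4
shape (_ ⋆)   = 5

-- Comparing shapes first leaves only the same-constructor cases to be matched.
infix 4 _≟ʳ_
_≟ʳ_ : DecidableEquality (Regex k)
≟-sameShape : (e f : Regex k) → shape e ≡ shape f → Dec (e ≡ f)

e ≟ʳ f with shape e ℕ.≟ shape f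
... | yes same  = ≟-sameShape e f same
... | no differ = no (differ ∘ cong shape)

≟-sameShape ∅ε      ∅ε        refl = yes refl
≟-sameShape ε       ε         refl = yes refl
≟-sameShape (chr a) (chr b)   refl = map′ (cong chr) (λ { refl → refl }) (a Fin.≟ b)
≟-sameShape (e ∣ f) (e′ ∣ f′) refl =
  map′ (uncurry (cong₂ _∣_)) (λ { refl → refl , refl }) (e ≟ʳ e′ ×-dec f ≟ʳ f′)
≟-sameShape (e · f) (e′ · f′) refl =
  map′ (uncurry (cong₂ _·_)) (λ { refl → refl , refl }) (e ≟ʳ e′ ×-dec f ≟ʳ f′)
≟-sameShape (e ⋆)   (f ⋆)     refl = map′ (cong _⋆) (λ { refl → refl }) (e ≟ʳ f)

·-split : w ∈L (e · f) → ∃₂ λ u v → w ≡ u ++ v × u ∈L e × v ∈L f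
·-split (·∈ p q) = _ , _ , refl , p , q

nullable? : (e : Regex k) → Dec ([] ∈L e)
nullable? ∅ε      = no λ ()
nullable? ε       = yes ε∈
nullable? (chr a) = no λ ()
nullable? (e ∣ f) =
  map′ [ ∣ˡ , ∣ʳ ]′ (λ { (∣ˡ p) → inj₁ p ; (∣ʳ q) → inj₂ q }) (nullable? e ⊎-dec nullable? f)
nullable? (e · f) = map′ (uncurry ·∈) []∈· (nullable? e ×-dec nullable? f)
  where
  []∈· : [] ∈L (e · f) → [] ∈L e × [] ∈L f
  []∈· r with u , v , []≡uv , p , q ← ·-split r
    with refl ← ++-conicalˡ u v (sym []≡uv) | refl ← ++-conicalʳ u v (sym []≡uv) = p , q
nullable? (e ⋆)   = yes ⋆ε

nonempty? : (e : Regex k) → Dec (∃ (_∈L e))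
nonempty? ∅ε      = no λ ()
nonempty? ε       = yes (_ , ε∈)
nonempty? (chr a) = yes (_ , chr∈ a)
nonempty? (e ∣ f) =
  map′ [ map₂ ∣ˡ , map₂ ∣ʳ ]′ (λ { (_ , ∣ˡ p) → inj₁ (_ , p) ; (_ , ∣ʳ q) → inj₂ (_ , q) })
       (nonempty? e ⊎-dec nonempty? f)
nonempty? (e · f) =
  map′ (λ ((_ , p) , (_ , q)) → _ , ·∈ p q) (λ { (_ , ·∈ p q) → (_ , p) , (_ , q) })
       (nonempty? e ×-dec nonempty? f)
nonempty? (e ⋆)   = yes (_ , ⋆ε)

∂ : Fin k → Regex k → List (Regex k)
∂ a ∅ε      = []
∂ a ε       = []
∂ a (chr b) = if does (a Fin.≟ b) then [ ε ] else []
∂ a (e ∣ f) = ∂ a e ++ ∂ a f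
∂ a (e · f) = map (_· f) (∂ a e) ++ (if does (nullable? e) then ∂ a f else [])
∂ a (e ⋆)   = map (_· (e ⋆)) (∂ a e)

·-any-split : ∀ {ds : List (Regex k)} → Any (λ d → w ∈L (d · f)) ds →
              ∃₂ λ u v → w ≡ u ++ v × Any (u ∈L_) ds × v ∈L f
·-any-split (here (·∈ p q)) = _ , _ , refl , here p , q
·-any-split (there r) with u , v , refl , p , q ← ·-any-split r = u , v , refl , there p , q

∂-complete : ∀ a {e : Regex k} {w} → (a ∷ w) ∈L e → Any (w ∈L_) (∂ a e)
∂-complete a p = go p refl
  where
  go : ∀ {e u w} → u ∈L e → u ≡ a ∷ w → Any (w ∈L_) (∂ a e)
  go (chr∈ _) refl rewrite dec-true (a Fin.≟ a) refl = here ε∈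
  go (∣ˡ p) eq = Anyₚ.++⁺ˡ (go p eq)
  go {e ∣ _} (∣ʳ p) eq = Anyₚ.++⁺ʳ (∂ a e) (go p eq)
  go (·∈ {[]} {e = e} p q) eq rewrite dec-true (nullable? e) p = Anyₚ.++⁺ʳ _ (go q eq)
  go (·∈ {_ ∷ _} p q) refl = Anyₚ.++⁺ˡ (Anyₚ.map⁺ (Any.map (λ r → ·∈ r q) (go p refl)))
  go (⋆∷ {[]} p q) eq = go q eq
  go (⋆∷ {_ ∷ _} p q) refl = Anyₚ.map⁺ (Any.map (λ r → ·∈ r q) (go p refl))

∂-sound : ∀ a (e : Regex k) {w} → Any (w ∈L_) (∂ a e) → (a ∷ w) ∈L e
∂-sound a (chr b) p with a Fin.≟ b
∂-sound a (chr b) (here ε∈) | yes refl = chr∈ a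
∂-sound a (e ∣ f) p = [ ∣ˡ ∘ ∂-sound a e , ∣ʳ ∘ ∂-sound a f ]′ (Anyₚ.++⁻ (∂ a e) p)
∂-sound a (e · f) p with Anyₚ.++⁻ (map (_· f) (∂ a e)) p
... | inj₁ q with _ , _ , refl , r , s ← ·-any-split (Anyₚ.map⁻ q) = ·∈ (∂-sound a e r) s
... | inj₂ q with nullable? e
...   | yes n = ·∈ n (∂-sound a f q)
∂-sound a (e ⋆) p with _ , _ , refl , r , s ← ·-any-split (Anyₚ.map⁻ p) = ⋆∷ (∂-sound a e r) s

∂⁺ : Regex k → List (Regex k)
∂⁺ ∅ε      = []
∂⁺ ε       = []
∂⁺ (chr b) = [ ε ]
∂⁺ (e ∣ f) = ∂⁺ e ++ ∂⁺ f
∂⁺ (e · f) = map (_· f) (∂⁺ e) ++ ∂⁺ f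
∂⁺ (e ⋆)   = map (_· (e ⋆)) (∂⁺ e)

∂⊆∂⁺ : ∀ a (e : Regex k) → ∂ a e ⊆ ∂⁺ e
∂⊆∂⁺ a (chr b) m with a Fin.≟ b
∂⊆∂⁺ a (chr b) (here refl) | yes _ = here refl
∂⊆∂⁺ a (e ∣ f) m = [ ∈-++⁺ˡ ∘ ∂⊆∂⁺ a e , ∈-++⁺ʳ (∂⁺ e) ∘ ∂⊆∂⁺ a f ]′ (∈-++⁻ (∂ a e) m)
∂⊆∂⁺ a (e · f) m with ∈-++⁻ (map (_· f) (∂ a e)) m
... | inj₁ q with _ , d∈ , refl ← ∈-map⁻ _ q = ∈-++⁺ˡ (∈-map⁺ _ (∂⊆∂⁺ a e d∈))
... | inj₂ q with nullable? e
...   | yes _ = ∈-++⁺ʳ (map (_· f) (∂⁺ e)) (∂⊆∂⁺ a f q)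
∂⊆∂⁺ a (e ⋆) m with _ , d∈ , refl ← ∈-map⁻ _ m = ∈-map⁺ _ (∂⊆∂⁺ a e d∈)

∂⁺-closed : ∀ a (e : Regex k) {d} → d ∈ ∂⁺ e → ∂ a d ⊆ ∂⁺ e
∂⁺-closed a (chr b) (here refl) ()
∂⁺-closed a (e ∣ f) m m′ with ∈-++⁻ (∂⁺ e) m
... | inj₁ q = ∈-++⁺ˡ (∂⁺-closed a e q m′)
... | inj₂ q = ∈-++⁺ʳ (∂⁺ e) (∂⁺-closed a f q m′)
∂⁺-closed a (e · f) m m′ with ∈-++⁻ (map (_· f) (∂⁺ e)) m
... | inj₂ q = ∈-++⁺ʳ (map (_· f) (∂⁺ e)) (∂⁺-closed a f q m′)
... | inj₁ q with d , d∈ , refl ← ∈-map⁻ _ q with ∈-++⁻ (map (_· f) (∂ a d)) m′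
...   | inj₁ q′ with _ , d′∈ , refl ← ∈-map⁻ _ q′ = ∈-++⁺ˡ (∈-map⁺ _ (∂⁺-closed a e d∈ d′∈))
...   | inj₂ q′ with nullable? d
...     | yes _ = ∈-++⁺ʳ (map (_· f) (∂⁺ e)) (∂⊆∂⁺ a f q′)
∂⁺-closed a (e ⋆) m m′ with d , d∈ , refl ← ∈-map⁻ _ m with ∈-++⁻ (map (_· (e ⋆)) (∂ a d)) m′
... | inj₁ q′ with _ , d′∈ , refl ← ∈-map⁻ _ q′ = ∈-map⁺ _ (∂⁺-closed a e d∈ d′∈)
... | inj₂ q′ with nullable? d
...   | yes _ with _ , d′∈ , refl ← ∈-map⁻ _ q′ = ∈-map⁺ _ (∂⊆∂⁺ a e d′∈)

states : Regex k → List (Regex k)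
states e = e ∷ ∂⁺ e

states-closed : ∀ a (e : Regex k) {d} → d ∈ states e → ∂ a d ⊆ states e
states-closed a e (here refl) = there ∘ ∂⊆∂⁺ a e
states-closed a e (there m)   = there ∘ ∂⁺-closed a e m

++-reassoc : ∀ {A : Set} (u p r t : List A) → (u ++ (p ++ r)) ++ t ≡ u ++ (p ++ (r ++ t))
++-reassoc u p r t = trans (++-assoc u (p ++ r) t) (cong (u ++_) (++-assoc p r t))

-- Generalised automata, whose transitions and acceptance conditions are regular expressions.
-- Accepts A c Q i w: w is read from state i along a run whose intermediate states lie in Q.
module StateElimination {k : ℕ} {St : Set} where

  data Accepts (A : St → St → Regex k) (c : St → Regex k) (Q : List St) : St → Str k → Set where
    stop : ∀ {i w} → w ∈L c i → Accepts A c Q i w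
    step : ∀ {i j u v} → j ∈ Q → u ∈L A i j → Accepts A c Q j v → Accepts A c Q i (u ++ v)

  bypass : (St → St → Regex k) → St → St → St → Regex k
  bypass A s i j = A i j ∣ (A i s · ((A s s ⋆) · A s j))

  bypassᶜ : (St → St → Regex k) → (St → Regex k) → St → St → Regex k
  bypassᶜ A c s i = c i ∣ (A i s · ((A s s ⋆) · c s))

  module _ (A : St → St → Regex k) (c : St → Regex k) (s : St) (Q : List St) where

    private
      Run Run⁻ : St → Str k → Set
      Run  = Accepts A c (s ∷ Q)
      Run⁻ = Accepts (bypass A s) (bypassᶜ A c s) Q

    loops : ∀ {p q} → p ∈L (A s s ⋆) → Run s q → Run s (p ++ q)
    loops ⋆ε run = run
    loops {q = q} (⋆∷ {p₁} {p₂} l ls) run =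
      subst (Run s) (sym (++-assoc p₁ p₂ q)) (step (here refl) l (loops ls run))

    bypass-sound : ∀ {i w} → Run⁻ i w → Run i w
    bypass-sound (stop (∣ˡ x))                   = stop x
    bypass-sound (stop (∣ʳ (·∈ u (·∈ ls x))))    = step (here refl) u (loops ls (stop x))
    bypass-sound (step j∈ (∣ˡ u) run)            = step (there j∈) u (bypass-sound run)
    bypass-sound {i} (step {v = t} j∈ (∣ʳ (·∈ {u} x (·∈ {p} {r} ls y))) run) =
      subst (Run i) (sym (++-reassoc u p r t))
        (step (here refl) x (loops ls (step (there j∈) y (bypass-sound run))))

    Leaving : Str k → Set
    Leaving w = ∃₂ λ p q → w ≡ p ++ q × p ∈L (A s s ⋆) ×
                (q ∈L c s ⊎ ∃ λ j → ∃₂ λ r t → j ∈ Q × q ≡ r ++ t × r ∈L A s j × Run⁻ j t)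

    bypass-complete : ∀ {i w} → Run i w → Run⁻ i w
    leaving : ∀ {w} → Run s w → Leaving w

    bypass-complete (stop x) = stop (∣ˡ x)
    bypass-complete (step (there j∈) u run) = step j∈ (∣ˡ u) (bypass-complete run)
    bypass-complete {i} (step {u = u} (here refl) x run) with leaving run
    ... | p , q , refl , ls , inj₁ y = stop (∣ʳ (·∈ x (·∈ ls y)))
    ... | p , q , refl , ls , inj₂ (j , r , t , j∈ , refl , y , run′) =
      subst (Run⁻ i) (++-reassoc u p r t) (step j∈ (∣ʳ (·∈ x (·∈ ls y))) run′)

    leaving (stop x) = [] , _ , refl , ⋆ε , inj₁ x
    leaving (step (there j∈) y run) =
      [] , _ , refl , ⋆ε , inj₂ (_ , _ , _ , j∈ , refl , y , bypass-complete run)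
    leaving (step {u = u} (here refl) l run) with p , q , refl , ls , rest ← leaving run =
      u ++ p , q , sym (++-assoc u p q) , ⋆∷ l ls , rest

  eliminate : (Q : List St) (A : St → St → Regex k) (c : St → Regex k) →
              Σ (St → Regex k) λ c* → ∀ {i w} → Accepts A c Q i w ⇔ (w ∈L c* i)
  eliminate [] A c = c , mk⇔ (λ { (stop x) → x }) stop
  eliminate (s ∷ Q) A c with c* , c*-correct ← eliminate Q (bypass A s) (bypassᶜ A c s) =
    c* , mk⇔ (to c*-correct ∘ bypass-complete A c s Q) (bypass-sound A c s Q ∘ from c*-correct)

guard : {P : Set} → Dec P → Regex k → Regex k
guard (yes _) e = e
guard (no _)  _ = ∅ε

∈L-guard : ∀ {P : Set} (p? : Dec P) → (w ∈L guard p? e) ⇔ (P × w ∈L e)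
∈L-guard (yes p) = mk⇔ (p ,_) proj₂
∈L-guard (no ¬p) = mk⇔ (λ ()) (⊥-elim ∘ ¬p ∘ proj₁)

⋃ : {X : Set} → List X → (X → Regex k) → Regex k
⋃ []       g = ∅ε
⋃ (x ∷ xs) g = g x ∣ ⋃ xs g

∈L-⋃ : ∀ {X : Set} (xs : List X) {g : X → Regex k} → (w ∈L ⋃ xs g) ⇔ Any (λ x → w ∈L g x) xs
∈L-⋃ xs = mk⇔ (sound xs) complete
  where
  sound : ∀ xs {g} → w ∈L ⋃ xs g → Any (λ x → w ∈L g x) xs
  sound (x ∷ xs) (∣ˡ p) = here p
  sound (x ∷ xs) (∣ʳ p) = there (sound xs p)
  complete : ∀ {xs g} → Any (λ x → w ∈L g x) xs → w ∈L ⋃ xs g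
  complete (here p)  = ∣ˡ p
  complete (there p) = ∣ʳ (complete p)

-- Intersection via the product of the partial-derivative automata, which is finite because
-- all iterated derivatives of e lie in states e.
module Product {k : ℕ} (e₁ e₂ : Regex k) where
  open StateElimination
  open import Data.List.Membership.DecPropositional (_≟ʳ_ {k}) using () renaming (_∈?_ to _∈ʳ?_)

  State : Set
  State = Regex k × Regex k

  edge? : ∀ a ((d₁ , d₂) (d₁′ , d₂′) : State) → Dec (d₁′ ∈ ∂ a d₁ × d₂′ ∈ ∂ a d₂)
  edge? a (d₁ , d₂) (d₁′ , d₂′) = d₁′ ∈ʳ? ∂ a d₁ ×-dec d₂′ ∈ʳ? ∂ a d₂

  final? : ((d₁ , d₂) : State) → Dec ([] ∈L d₁ × [] ∈L d₂)
  final? (d₁ , d₂) = nullable? d₁ ×-dec nullable? d₂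

  transition : State → State → Regex k
  transition i j = ⋃ (allFin k) λ a → guard (edge? a i j) (chr a)

  accepting : State → Regex k
  accepting i = guard (final? i) ε

  stateSpace : List State
  stateSpace = cartesianProduct (states e₁) (states e₂)

  complete : ∀ w {d₁ d₂} → d₁ ∈ states e₁ → d₂ ∈ states e₂ → w ∈L d₁ → w ∈L d₂ →
             Accepts transition accepting stateSpace (d₁ , d₂) w
  complete []      _  _  p q = stop (from (∈L-guard _) ((p , q) , ε∈))
  complete (a ∷ w) m₁ m₂ p q
    with d₁′ , n₁ , p′ ← find (∂-complete a p) | d₂′ , n₂ , q′ ← find (∂-complete a q) =
    step (∈-cartesianProduct⁺ m₁′ m₂′)
         (from (∈L-⋃ (allFin k)) (lose (∈-allFin a) (from (∈L-guard _) ((n₁ , n₂) , chr∈ a))))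
         (complete w m₁′ m₂′ p′ q′)
    where
    m₁′ : d₁′ ∈ states e₁
    m₁′ = states-closed a e₁ m₁ n₁
    m₂′ : d₂′ ∈ states e₂
    m₂′ = states-closed a e₂ m₂ n₂

  sound : ∀ {Q d₁ d₂ w} → Accepts transition accepting Q (d₁ , d₂) w → w ∈L d₁ × w ∈L d₂
  sound {d₁ = d₁} {d₂} (stop x) with (p , q) , ε∈ ← to (∈L-guard (final? (d₁ , d₂))) x = p , q
  sound {d₁ = d₁} {d₂} (step {j = j} _ u acc)
    with a , _ , x ← find (to (∈L-⋃ (allFin k)) u)
    with (n₁ , n₂) , chr∈ _ ← to (∈L-guard (edge? a (d₁ , d₂) j)) x
    with p , q ← sound acc = ∂-sound a d₁ (lose n₁ p) , ∂-sound a d₂ (lose n₂ q)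

  intersection : Σ (Regex k) λ g → ∀ {w} → (w ∈L g) ⇔ (w ∈L e₁ × w ∈L e₂)
  intersection with c* , correct ← eliminate stateSpace transition accepting =
    c* (e₁ , e₂) ,
    mk⇔ (sound ∘ from correct) (λ (p , q) → to correct (complete _ (here refl) (here refl) p q))

_⊓_ : Regex k → Regex k → Regex k
e ⊓ f = proj₁ (Product.intersection e f)

∈L-⊓ : (w ∈L (e ⊓ f)) ⇔ (w ∈L e × w ∈L f)
∈L-⊓ {e = e} {f} = proj₂ (Product.intersection e f)

Σ* : Regex k
Σ* {k} = ⋃ (allFin k) chr ⋆

Σ*-universal : (w : Str k) → w ∈L Σ*
Σ*-universal []      = ⋆ε
Σ*-universal (a ∷ w) = ⋆∷ (from (∈L-⋃ (allFin _)) (lose (∈-allFin a) (chr∈ a))) (Σ*-universal w)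

⋂ : List (Regex k) → Regex k
⋂ = foldr _⊓_ Σ*

∈L-⋂ : ∀ (es : List (Regex k)) → (w ∈L ⋂ es) ⇔ All (w ∈L_) es
∈L-⋂ []       = mk⇔ (λ _ → []) (λ _ → Σ*-universal _)
∈L-⋂ (e ∷ es) = mk⇔ (λ m → let p , q = to ∈L-⊓ m in p ∷ to (∈L-⋂ es) q)
                    (λ { (p ∷ ps) → from ∈L-⊓ (p , from (∈L-⋂ es) ps) })

word : Str k → Regex k
word []      = ε
word (a ∷ s) = chr a · word s

∈L-word : ∀ (s : Str k) → (w ∈L word s) ⇔ (w ≡ s)
∈L-word s = mk⇔ (sound s) λ { refl → complete s }
  where
  sound : ∀ s → w ∈L word s → w ≡ s
  sound []      ε∈                = refl
  sound (a ∷ s) (·∈ (chr∈ _) p) = cong (a ∷_) (sound s p)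
  complete : ∀ s → s ∈L word s
  complete []      = ε∈
  complete (a ∷ s) = ·∈ (chr∈ a) (complete s)

countIn-++ : ∀ v (xs ys : List Var) → countIn v (xs ++ ys) ≡ countIn v xs + countIn v ys
countIn-++ v []       ys = refl
countIn-++ v (x ∷ xs) ys =
  trans (cong (hit +_) (countIn-++ v xs ys)) (sym (+-assoc hit (countIn v xs) (countIn v ys)))
  where
  hit : ℕ
  hit = if does (v ℕ.≟ x) then 1 else 0

countIn-∈ : v ∈ xs → 1 ≤ countIn v xs
countIn-∈ {v} (here refl) rewrite dec-true (v ℕ.≟ v) refl = s≤s z≤n
countIn-∈ (there m) = ≤-trans (countIn-∈ m) (m≤n+m _ _)

once-++ : ∀ xs ys → countIn v (xs ++ ys) ≤ 1 → v ∈ xs → v ∉ ys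
once-++ {v} xs ys once v∈xs v∈ys = <-irrefl refl (begin
  2                              ≤⟨ +-mono-≤ (countIn-∈ v∈xs) (countIn-∈ v∈ys) ⟩
  countIn v xs + countIn v ys    ≡⟨ countIn-++ v xs ys ⟨
  countIn v (xs ++ ys)           ≤⟨ once ⟩
  1                              ∎)
  where open ≤-Reasoning

once-++ˡ : ∀ xs ys → countIn v (xs ++ ys) ≤ 1 → countIn v xs ≤ 1
once-++ˡ {v} xs ys once =
  ≤-trans (m≤m+n _ _) (≤-trans (≤-reflexive (sym (countIn-++ v xs ys))) once)

once-++ʳ : ∀ xs ys → countIn v (xs ++ ys) ≤ 1 → countIn v ys ≤ 1
once-++ʳ {v} xs ys once =
  ≤-trans (m≤n+m _ _) (≤-trans (≤-reflexive (sym (countIn-++ v xs ys))) once)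

once⇒Unique : (∀ {v} → v ∈ xs → countIn v xs ≤ 1) → Unique xs
once⇒Unique {[]}     _    = []
once⇒Unique {x ∷ xs} once =
  ¬Any⇒All¬ xs (once-++ [ x ] xs (once (here refl)) (here refl)) ∷
  once⇒Unique (once-++ʳ [ x ] xs ∘ once ∘ there)

occ-∷ : ∀ (E : Eqn k) Es v → occ (E ∷ Es) v ≡ countIn v (eqVars E) + occ Es v
occ-∷ E Es v = countIn-++ v (eqVars E) (allVars Es)

occ-sum : ∀ (Es : List (Eqn k)) v → occ Es v ≡ sum (map (λ E → countIn v (eqVars E)) Es)
occ-sum []       v = refl
occ-sum (E ∷ Es) v = trans (occ-∷ E Es v) (cong (_ +_) (occ-sum Es v))

occ-↭ : ∀ {Es Fs : List (Eqn k)} → Es ↭ Fs → ∀ v → occ Es v ≡ occ Fs v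
occ-↭ {Es = Es} {Fs} p v =
  trans (occ-sum Es v) (trans (sum-↭ (↭.map⁺ _ p)) (sym (occ-sum Fs v)))

occ-++ : ∀ (Es Fs : List (Eqn k)) v → occ (Es ++ Fs) v ≡ occ Es v + occ Fs v
occ-++ Es Fs v =
  trans (cong (countIn v) (concatMap-++ eqVars Es Fs)) (countIn-++ v (allVars Es) (allVars Fs))

occ-≤-++ : ∀ (Es Fs : List (Eqn k)) v → occ Fs v ≤ occ (Es ++ Fs) v
occ-≤-++ Es Fs v = ≤-trans (m≤n+m (occ Fs v) (occ Es v)) (≤-reflexive (sym (occ-++ Es Fs v)))

eqs : Flow k → List (Eqn k)
eqs = map proj₁

data Admissible {k : ℕ} : Flow k → Set where
  []  : Admissible []
  bwd : ∀ {E fl} → Backwardable (fun (fn E)) → occ (E ∷ eqs fl) (lhs E) ≤ 1 →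
        Admissible fl → Admissible ((E , ⟶) ∷ fl)
  fwd : ∀ {E fl} → Forwardable (fun (fn E)) → All (λ y → occ (E ∷ eqs fl) y ≤ 1) (toList (args E)) →
        Admissible fl → Admissible ((E , ⟵) ∷ fl)

lhs-once⇒∉args : (E : Eqn k) (Es : List (Eqn k)) → occ (E ∷ Es) (lhs E) ≤ 1 →
                 lhs E ∉ toList (args E)
lhs-once⇒∉args E Es once =
  once-++ [ lhs E ] (toList (args E) ++ allVars Es) once (here refl) ∘ ∈-++⁺ˡ

lhs-once⇒∉later : (E : Eqn k) (Es : List (Eqn k)) → occ (E ∷ Es) (lhs E) ≤ 1 →
                  lhs E ∉ allVars Es
lhs-once⇒∉later E Es once =
  once-++ [ lhs E ] (toList (args E) ++ allVars Es) once (here refl) ∘ ∈-++⁺ʳ (toList (args E))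

module _ (E : Eqn k) (Es : List (Eqn k))
         (once : All (λ y → occ (E ∷ Es) y ≤ 1) (toList (args E))) where

  private
    once-rest : ∀ {y} → y ∈ toList (args E) → countIn y (toList (args E) ++ allVars Es) ≤ 1
    once-rest = once-++ʳ [ lhs E ] (toList (args E) ++ allVars Es) ∘ All.lookup once

  args-once⇒Unique : Unique (toList (args E))
  args-once⇒Unique = once⇒Unique (once-++ˡ (toList (args E)) (allVars Es) ∘ once-rest)

  args-once⇒lhs∉args : lhs E ∉ toList (args E)
  args-once⇒lhs∉args m =
    once-++ [ lhs E ] (toList (args E) ++ allVars Es) (All.lookup once m) (here refl) (∈-++⁺ˡ m)

  args-once⇒Disjoint : Disjoint (toList (args E)) (allVars Es)
  args-once⇒Disjoint (m , m′) = once-++ (toList (args E)) (allVars Es) (once-rest m) m m′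

MarkedOnce : List Var → List (Eqn k) → Set
MarkedOnce M Es = ∀ {v} → v ∈ M → occ Es v ≤ 1

addMarks-⊆ : ∀ M vs {v} → v ∈ addMarks M vs → v ∈ M ⊎ v ∈ vs
addMarks-⊆ M []       m = inj₁ m
addMarks-⊆ M (x ∷ vs) m with x ∈? M
... | yes _ = Sum.map₂ there (addMarks-⊆ M vs m)
... | no _ with addMarks-⊆ (M ++ [ x ]) vs m
...   | inj₂ m′ = inj₂ (there m′)
...   | inj₁ m′ = Sum.map₂ (λ { (here refl) → here refl }) (∈-++⁻ M m′)

stepA-once : ∀ (rem : List (Eqn k)) M → MarkedOnce M rem → MarkedOnce (stepA rem M) rem
stepA-once rem M once m with addMarks-⊆ M _ m
... | inj₁ m′ = once m′
... | inj₂ m′ = ≤-reflexive (proj₂ (∈-filter⁻ (λ v → occ rem v ℕ.≟ 1) {xs = allVars rem} m′))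

data StepB (M : List Var) (E : Eqn k) (fl : Flow k) (rest : List (Eqn k)) :
           Flow k × List (Eqn k) → Set where
  bwd  : Backwardable (fun (fn E)) → lhs E ∈ M → StepB M E fl rest ((E , ⟶) ∷ fl , rest)
  fwd  : Forwardable (fun (fn E)) → All (_∈ M) (toList (args E)) →
         StepB M E fl rest ((E , ⟵) ∷ fl , rest)
  keep : StepB M E fl rest (fl , E ∷ rest)

allB-marked : ∀ M (xs : List Var) → allB (map (marked? M) xs) ≡ true → All (_∈ M) xs
allB-marked M []       _ = []
allB-marked M (x ∷ xs) all with x ∈? M
... | yes m = m ∷ allB-marked M xs all

stepB-view-fwd : ∀ M (E : Eqn k) {fl rest} →
  StepB M E fl rest (if allB (map (marked? M) (toList (args E))) ∧ does (fwd? (fn E))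
                     then ((E , ⟵) ∷ fl , rest) else (fl , E ∷ rest))
stepB-view-fwd M E with allB (map (marked? M) (toList (args E))) in all | fwd? (fn E)
... | true  | yes F = fwd F (allB-marked M _ all)
... | true  | no _  = keep
... | false | _     = keep

stepB-view : ∀ M (E : Eqn k) Es →
             StepB M E (proj₁ (stepB M Es)) (proj₂ (stepB M Es)) (stepB M (E ∷ Es))
stepB-view M E Es with lhs E ∈? M | bwd? (fn E)
... | yes m | yes B = bwd B m
... | yes _ | no _  = stepB-view-fwd M E
... | no _  | _     = stepB-view-fwd M E

stepB-↭ : ∀ M (rem : List (Eqn k)) → eqs (proj₁ (stepB M rem)) ++ proj₂ (stepB M rem) ↭ rem
stepB-↭ M []       = ↭-refl
stepB-↭ M (E ∷ Es) = go (stepB-view M E Es) (stepB-↭ M Es)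
  where
  go : ∀ {fl rest r} → StepB M E fl rest r → eqs fl ++ rest ↭ Es → eqs (proj₁ r) ++ proj₂ r ↭ E ∷ Es
  go (bwd _ _)          split = ↭-prep E split
  go (fwd _ _)          split = ↭-prep E split
  go {fl} {rest} keep   split = ↭-trans (↭.shift E (eqs fl) rest) (↭-prep E split)

-- P collects the equations kept earlier in the round, which are removed only in later rounds.
stepB-admissible : ∀ M (rem P : List (Eqn k)) → MarkedOnce M (P ++ rem) →
  ∀ {fut} → Admissible fut → eqs fut ↭ P ++ proj₂ (stepB M rem) →
  Admissible (proj₁ (stepB M rem) ++ fut)
stepB-admissible M []       P once adm _ = adm
stepB-admissible M (E ∷ Es) P once {fut} adm fut↭ =
  go (stepB-view M E Es) (stepB-↭ M Es) (stepB-admissible M Es) fut↭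
  where
  once-Es : MarkedOnce M (P ++ Es)
  once-Es {v} m = begin
    occ (P ++ Es) v         ≤⟨ occ-≤-++ [ E ] (P ++ Es) v ⟩
    occ (E ∷ P ++ Es) v     ≡⟨ occ-↭ (↭-sym (↭.shift E P Es)) v ⟩
    occ (P ++ E ∷ Es) v     ≤⟨ once m ⟩
    1                       ∎
    where open ≤-Reasoning

  E-first : ∀ {fl rest} → eqs fl ++ rest ↭ Es → eqs fut ↭ P ++ rest →
            E ∷ eqs (fl ++ fut) ↭ P ++ E ∷ Es
  E-first {fl} {rest} split fut↭ = begin
    E ∷ eqs (fl ++ fut)        ≡⟨ cong (E ∷_) (map-++ proj₁ fl fut) ⟩
    E ∷ eqs fl ++ eqs fut      ↭⟨ ↭-prep E (↭.++⁺ˡ (eqs fl) fut↭) ⟩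
    (E ∷ eqs fl) ++ P ++ rest  ↭⟨ ↭.shifts (E ∷ eqs fl) P ⟩
    P ++ E ∷ eqs fl ++ rest    ↭⟨ ↭.++⁺ˡ P (↭-prep E split) ⟩
    P ++ E ∷ Es                ∎
    where open PermutationReasoning

  go : ∀ {fl rest r} → StepB M E fl rest r → eqs fl ++ rest ↭ Es →
       (∀ P′ → MarkedOnce M (P′ ++ Es) → ∀ {fut} → Admissible fut → eqs fut ↭ P′ ++ rest →
        Admissible (fl ++ fut)) →
       eqs fut ↭ P ++ proj₂ r → Admissible (proj₁ r ++ fut)
  go (bwd B m) split ih fut↭ =
    bwd B (≤-trans (≤-reflexive (occ-↭ (E-first split fut↭) _)) (once m)) (ih P once-Es adm fut↭)
  go (fwd F ms) split ih fut↭ =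
    fwd F (All.map (λ m → ≤-trans (≤-reflexive (occ-↭ (E-first split fut↭) _)) (once m)) ms)
        (ih P once-Es adm fut↭)
  go {rest = rest} keep split ih fut↭ =
    ih (P ++ [ E ]) (subst (MarkedOnce M) (sym (++-assoc P [ E ] Es)) once) adm
       (subst (eqs fut ↭_) (sym (++-assoc P [ E ] rest)) fut↭)

runRounds-admissible : ∀ n (rem : List (Eqn k)) M acc {fl} → MarkedOnce M rem →
  runRounds n (mstate rem M acc) ≡ just fl →
  ∃ λ fut → fl ≡ acc ++ fut × Admissible fut × eqs fut ↭ rem
runRounds-admissible (suc n) rem M acc {fl} once run = next (length M′ ≡ᵇ length M) run
  where
  M′ : List Var
  M′ = stepA rem M

  new : Flow _
  new = proj₁ (stepB M′ rem)

  rem′ : List (Eqn _)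
  rem′ = proj₂ (stepB M′ rem)

  split : eqs new ++ rem′ ↭ rem
  split = stepB-↭ M′ rem

  extend : ∀ {fut} → Admissible fut → eqs fut ↭ rem′ → Admissible (new ++ fut)
  extend = stepB-admissible M′ rem [] (stepA-once rem M once)

  once′ : MarkedOnce M′ rem′
  once′ {v} m = ≤-trans (occ-≤-++ (eqs new) rem′ v)
                        (≤-trans (≤-reflexive (occ-↭ split v)) (stepA-once rem M once m))

  finish : ∀ {rest} → eqs new ++ rest ↭ rem →
           (∀ {fut} → Admissible fut → eqs fut ↭ rest → Admissible (new ++ fut)) →
           (if null rest then just (acc ++ new) else nothing) ≡ just fl →
           ∃ λ fut → fl ≡ acc ++ fut × Admissible fut × eqs fut ↭ rem
  finish {[]} split-new extend-new refl =
    new , refl , subst Admissible (++-identityʳ new) (extend-new [] ↭-refl) ,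
    subst (_↭ rem) (++-identityʳ (eqs new)) split-new

  next : ∀ b → (if b then (if null rem′ then just (acc ++ new) else nothing)
                else runRounds n (mstate rem′ M′ (acc ++ new))) ≡ just fl →
         ∃ λ fut → fl ≡ acc ++ fut × Admissible fut × eqs fut ↭ rem
  next true  run = finish split extend run
  next false run
    with fut , refl , adm , fut↭ ← runRounds-admissible n rem′ M′ (acc ++ new) once′ run =
    new ++ fut , ++-assoc acc new fut , extend adm fut↭ , (begin
      eqs (new ++ fut)    ≡⟨ map-++ proj₁ new fut ⟩
      eqs new ++ eqs fut  ↭⟨ ↭.++⁺ˡ (eqs new) fut↭ ⟩
      eqs new ++ rem′     ↭⟨ split ⟩
      rem                 ∎)
    where open PermutationReasoning

orderable⇒admissible : (S : Sequent k) → Orderable S → ∃ λ fl → Admissible fl × eqs fl ↭ eqsOf S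
orderable⇒admissible S (_ , run)
  with fl , refl , adm , fl↭ ←
         runRounds-admissible (suc (length (allVars (eqsOf S)))) (eqsOf S) [] [] (λ ()) run =
  fl , adm , fl↭

≈ˢ-rebase : ∀ {S S′ X : Sequent k} → S ≈ˢ S′ → S ≈ˢ X → S′ ≈ˢ X
≈ˢ-rebase S≈S′ S≈X c = ⇔.trans (⇔.sym (S≈S′ c)) (S≈X c)

RCP-resp-≈ˢ : ∀ {S S′ : Sequent k} → S ≈ˢ S′ → RCP S → RCP S′
RCP-resp-≈ˢ S≈S′ (close Γ x es S≈ empty) = close Γ x es (≈ˢ-rebase S≈S′ S≈) empty
RCP-resp-≈ˢ S≈S′ (intersect Γ x es e S≈ meet p) = intersect Γ x es e (≈ˢ-rebase S≈S′ S≈) meet p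
RCP-resp-≈ˢ S≈S′ (fwd-prop Γ E es e S≈ image p) = fwd-prop Γ E es e (≈ˢ-rebase S≈S′ S≈) image p
RCP-resp-≈ˢ S≈S′ (bwd-prop Γ E e t ts S≈ preimage ps) =
  bwd-prop Γ E e t ts (≈ˢ-rebase S≈S′ S≈) preimage ps

absorb : R ⊆ T → T ≈ˢ (T ++ R)
absorb {T = T} R⊆T _ = mk⇔ ∈-++⁺ˡ ([ id , R⊆T ]′ ∘ ∈-++⁻ T)

absorb-middle : R ⊆ T → (T ++ U) ≈ˢ (T ++ R ++ U)
absorb-middle {R = R} {T} R⊆T _ =
  mk⇔ ([ ∈-++⁺ˡ , ∈-++⁺ʳ T ∘ ∈-++⁺ʳ R ]′ ∘ ∈-++⁻ T)
      ([ ∈-++⁺ˡ , [ ∈-++⁺ˡ ∘ R⊆T , ∈-++⁺ʳ T ]′ ∘ ∈-++⁻ R ]′ ∘ ∈-++⁻ T)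

close′ : ∀ x es → regs x es ⊆ T → (∀ w → ¬ All (w ∈L_) es) → RCP T
close′ {T = T} x es R⊆T = close T x es (absorb R⊆T)

intersect′ : ∀ x es e → regs x es ⊆ T → (∀ w → (w ∈L e) ⇔ All (w ∈L_) es) →
             RCP (T ++ [ x ∈ʳ e ]) → RCP T
intersect′ {T = T} x es e R⊆T = intersect T x es e (absorb R⊆T)

fwd-prop′ : ∀ (E : Eqn k) es e → eqn E ∈ T → regsᵛ (args E) es ⊆ T →
            (∀ w → (w ∈L e) ⇔ (∃ λ ws → (ws ∈Lᵛ es) × fun (fn E) ws ≡ w)) →
            RCP (T ++ [ lhs E ∈ʳ e ]) → RCP T
fwd-prop′ {T = T} E es e E∈T args⊆T image p =
  fwd-prop T E es e (absorb used⊆T) image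
    (RCP-resp-≈ˢ (subst ((T ++ [ lhs E ∈ʳ e ]) ≈ˢ_) (++-assoc T _ _) (absorb premise⊆)) p)
  where
  used⊆T : regsᵛ (args E) es ++ [ eqn E ] ⊆ T
  used⊆T = [ args⊆T , (λ { (here refl) → E∈T }) ]′ ∘ ∈-++⁻ (regsᵛ (args E) es)

  premise⊆ : eqn E ∷ regsᵛ (args E) es ⊆ T ++ [ lhs E ∈ʳ e ]
  premise⊆ (here refl) = ∈-++⁺ˡ E∈T
  premise⊆ (there m)   = ∈-++⁺ˡ (args⊆T m)

bwd-prop′ : ∀ (E : Eqn k) e t ts → eqn E ∈ T → (lhs E ∈ʳ e) ∈ T →
            (∀ ws → (fun (fn E) ws ∈L e) ⇔ Any (ws ∈Lᵛ_) (t ∷ ts)) →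
            All (λ tᵢ → RCP (T ++ regsᵛ (args E) tᵢ)) (t ∷ ts) → RCP T
bwd-prop′ {T = T} E e t ts E∈T x∈T preimage ps =
  bwd-prop T E e t ts (absorb used⊆T) preimage (All.map (RCP-resp-≈ˢ (absorb-middle used⊆T)) ps)
  where
  used⊆T : (lhs E ∈ʳ e) ∷ eqn E ∷ [] ⊆ T
  used⊆T (here refl)         = x∈T
  used⊆T (there (here refl)) = E∈T

-- Bwd-Prop with an empty preimage would have no premise, which bwd-prop does not allow:
-- a function of positive arity takes one premise with first argument in ∅, and a
-- constant c is handled by forward propagation of {c}.
refute-empty-preimage : ∀ (E : Eqn k) e → eqn E ∈ T → (lhs E ∈ʳ e) ∈ T →
                        (∀ ws → ¬ fun (fn E) ws ∈L e) → RCP T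
refute-empty-preimage {T = T} E@(x ≐ record { arity = zero ; fun = f } ⟨ [] ⟩) e E∈T x∈T none =
  fwd-prop′ E [] (word (f [])) E∈T (λ ()) image (close′ x (e ∷ word (f []) ∷ []) regs⊆ disjoint)
  where
  image : ∀ w → (w ∈L word (f [])) ⇔ (∃ λ ws → (ws ∈Lᵛ []) × f ws ≡ w)
  image w = mk⇔ (λ m → [] , tt , sym (to (∈L-word (f [])) m))
                (λ { ([] , _ , refl) → from (∈L-word (f [])) refl })
  regs⊆ : regs x (e ∷ word (f []) ∷ []) ⊆ T ++ [ x ∈ʳ word (f []) ]
  regs⊆ (here refl)         = ∈-++⁺ˡ x∈T
  regs⊆ (there (here refl)) = ∈-++⁺ʳ T (here refl)
  disjoint : ∀ w → ¬ All (w ∈L_) (e ∷ word (f []) ∷ [])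
  disjoint w (w∈e ∷ w∈c ∷ []) with refl ← to (∈L-word (f [])) w∈c = none [] w∈e
refute-empty-preimage {T = T} E@(x ≐ record { arity = suc n ; fun = f } ⟨ y ∷ ys ⟩) e E∈T x∈T none =
  bwd-prop′ E e t [] E∈T x∈T preimage
    (close′ y [ ∅ε ] (λ { (here refl) → ∈-++⁺ʳ T (here refl) }) (λ { _ (() ∷ []) }) ∷ [])
  where
  t : Vec (Regex _) (suc n)
  t = ∅ε ∷ replicate n ∅ε
  preimage : ∀ ws → (f ws ∈L e) ⇔ Any (ws ∈Lᵛ_) [ t ]
  preimage (w ∷ ws) = mk⇔ (⊥-elim ∘ none (w ∷ ws)) (λ { (here (() , _)) })

regsOf : Sequent k → Var → List (Regex k)
regsOf []             x = []
regsOf ((y ∈ʳ e) ∷ T) x with x ℕ.≟ y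
... | yes _ = e ∷ regsOf T x
... | no _  = regsOf T x
regsOf (eqn _ ∷ T)    x = regsOf T x

regsOf-sound : ∀ (T : Sequent k) x {e} → e ∈ regsOf T x → (x ∈ʳ e) ∈ T
regsOf-sound ((y ∈ʳ e) ∷ T) x m with x ℕ.≟ y | m
... | yes refl | here refl = here refl
... | yes _    | there m′  = there (regsOf-sound T x m′)
... | no _     | m′        = there (regsOf-sound T x m′)
regsOf-sound (eqn _ ∷ T) x m = there (regsOf-sound T x m)

regsOf-complete : ∀ (T : Sequent k) x {e} → (x ∈ʳ e) ∈ T → e ∈ regsOf T x
regsOf-complete ((y ∈ʳ e) ∷ T) x m with x ℕ.≟ y | m
... | yes _   | here refl = here refl
... | no x≢x  | here refl = ⊥-elim (x≢x refl)
... | yes _   | there m′  = there (regsOf-complete T x m′)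
... | no _    | there m′  = regsOf-complete T x m′
regsOf-complete (eqn _ ∷ T) x (there m) = regsOf-complete T x m

regs-regsOf : ∀ (T : Sequent k) x → regs x (regsOf T x) ⊆ T
regs-regsOf T x m with _ , e∈ , refl ← ∈-map⁻ _ m = regsOf-sound T x e∈

meet : Sequent k → Var → Regex k
meet T x = ⋂ (regsOf T x)

∈L-meet : ∀ {T : Sequent k} {x w} → (w ∈L meet T x) ⇔ (∀ {e} → (x ∈ʳ e) ∈ T → w ∈L e)
∈L-meet {T = T} {x} {w} = mk⇔ sound complete
  where
  sound : w ∈L meet T x → ∀ {e} → (x ∈ʳ e) ∈ T → w ∈L e
  sound m c∈T = All.lookup (to (∈L-⋂ _) m) (regsOf-complete T x c∈T)
  complete : (∀ {e} → (x ∈ʳ e) ∈ T → w ∈L e) → w ∈L meet T x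
  complete h = from (∈L-⋂ _) (All.tabulate (h ∘ regsOf-sound T x))

intersect-meet : T ⊆ U → RCP (U ++ [ x ∈ʳ meet T x ]) → RCP U
intersect-meet {T = T} {x = x} T⊆U =
  intersect′ x (regsOf T x) (meet T x) (T⊆U ∘ regs-regsOf T x) (λ _ → ∈L-⋂ _)

intersect-meets : ∀ ys → T ⊆ U → RCP (U ++ map (λ y → y ∈ʳ meet T y) ys) → RCP U
intersect-meets {U = U} []       _   p = subst RCP (++-identityʳ U) p
intersect-meets {T = T} {U} (y ∷ ys) T⊆U p =
  intersect-meet T⊆U (intersect-meets ys (∈-++⁺ˡ ∘ T⊆U)
    (subst RCP (sym (++-assoc U [ y ∈ʳ meet T y ] _)) p))

RegSat : (Var → Str k) → Sequent k → Set
RegSat ρ T = ∀ {x e} → (x ∈ʳ e) ∈ T → ρ x ∈L e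

EqsSat : (Var → Str k) → List (Eqn k) → Set
EqsSat ρ = All (Sat ρ ∘ eqn)

Unsat : Sequent k → List (Eqn k) → Set
Unsat {k} T Es = ∀ (ρ : Var → Str k) → RegSat ρ T → EqsSat ρ Es → ⊥

Unsat-mono : T ⊆ U → Unsat T Es → Unsat U Es
Unsat-mono T⊆U unsat ρ sat = unsat ρ (sat ∘ T⊆U)

vmap-cong-∈ : ∀ {A : Set} {f g : Var → A} (ys : Vec Var n) → (∀ {v} → v ∈ toList ys → f v ≡ g v) →
              vmap f ys ≡ vmap g ys
vmap-cong-∈ []       _  = refl
vmap-cong-∈ (y ∷ ys) eq = cong₂ _∷_ (eq (here refl)) (vmap-cong-∈ ys (eq ∘ there))

Sat-agree : ∀ {ρ ρ′ : Var → Str k} (E : Eqn k) → (∀ {v} → v ∈ eqVars E → ρ v ≡ ρ′ v) →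
            Sat ρ (eqn E) → Sat ρ′ (eqn E)
Sat-agree E agree sat =
  trans (sym (agree (here refl)))
        (trans sat (cong (fun (fn E)) (vmap-cong-∈ (args E) (agree ∘ there))))

EqsSat-agree : ∀ {ρ ρ′ : Var → Str k} (Es : List (Eqn k)) → (∀ {v} → v ∈ allVars Es → ρ v ≡ ρ′ v) →
               EqsSat ρ Es → EqsSat ρ′ Es
EqsSat-agree []       _     []           = []
EqsSat-agree (E ∷ Es) agree (sat ∷ sats) =
  Sat-agree E (agree ∘ ∈-++⁺ˡ) sat ∷ EqsSat-agree Es (agree ∘ ∈-++⁺ʳ (eqVars E)) sats

_[_≔_] : (Var → Str k) → Vec Var n → Vec (Str k) n → Var → Str k
(ρ [ []     ≔ []     ]) v = ρ v
(ρ [ y ∷ ys ≔ w ∷ ws ]) v with v ℕ.≟ y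
... | yes _ = w
... | no _  = (ρ [ ys ≔ ws ]) v

[≔]-∉ : ∀ (ρ : Var → Str k) (ys : Vec Var n) ws → v ∉ toList ys → (ρ [ ys ≔ ws ]) v ≡ ρ v
[≔]-∉ ρ []       []       _  = refl
[≔]-∉ {v = v} ρ (y ∷ ys) (w ∷ ws) v∉ with v ℕ.≟ y
... | yes v≡y = ⊥-elim (v∉ (here v≡y))
... | no _    = [≔]-∉ ρ ys ws (v∉ ∘ there)

[≔]-∈ : ∀ {h : Var → Regex k} (ys : Vec Var n) {ws} → ws ∈Lᵛ vmap h ys → v ∈ toList ys →
        (ρ [ ys ≔ ws ]) v ∈L h v
[≔]-∈ {v = v} (y ∷ ys) {w ∷ ws} (w∈ , ws∈) m with v ℕ.≟ y | m
... | yes refl | _        = w∈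
... | no v≢y   | here eq  = ⊥-elim (v≢y eq)
... | no _     | there m′ = [≔]-∈ ys ws∈ m′

[≔]-vmap : ∀ (ys : Vec Var n) ws → Unique (toList ys) → vmap (ρ [ ys ≔ ws ]) ys ≡ ws
[≔]-vmap []       []       _           = refl
[≔]-vmap {ρ = ρ} (y ∷ ys) (w ∷ ws) (y∉ys ∷ u) =
  cong₂ _∷_ updated (trans (vmap-cong-∈ ys untouched) ([≔]-vmap ys ws u))
  where
  updated : (ρ [ y ∷ ys ≔ w ∷ ws ]) y ≡ w
  updated with y ℕ.≟ y
  ... | yes _   = refl
  ... | no y≢y  = ⊥-elim (y≢y refl)
  untouched : ∀ {v} → v ∈ toList ys → (ρ [ y ∷ ys ≔ w ∷ ws ]) v ≡ (ρ [ ys ≔ ws ]) v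
  untouched {v} m with v ℕ.≟ y
  ... | yes refl = ⊥-elim (All.lookup y∉ys m refl)
  ... | no _     = refl

RegSat-[≔] : ∀ {T : Sequent k} (ys : Vec Var n) {ws} → RegSat ρ T → ws ∈Lᵛ vmap (meet T) ys →
             RegSat (ρ [ ys ≔ ws ]) T
RegSat-[≔] ys {ws} sat ws∈ {z} c∈T with z ∈? toList ys
... | yes z∈ = to ∈L-meet ([≔]-∈ ys ws∈ z∈) c∈T
... | no z∉  = subst (_∈L _) (sym ([≔]-∉ _ ys ws z∉)) (sat c∈T)

regsᵛ-sat : ∀ (ys : Vec Var n) (t : Vec (Regex k) n) → RegSat ρ (regsᵛ ys t) → vmap ρ ys ∈Lᵛ t
regsᵛ-sat []       []       _   = tt
regsᵛ-sat (y ∷ ys) (e ∷ t)  sat = sat (here refl) , regsᵛ-sat ys t (sat ∘ there)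

regsᵛ-vmap : ∀ (h : Var → Regex k) (ys : Vec Var n) →
             regsᵛ ys (vmap h ys) ≡ map (λ y → y ∈ʳ h y) (toList ys)
regsᵛ-vmap h []       = refl
regsᵛ-vmap h (y ∷ ys) = cong ((y ∈ʳ h y) ∷_) (regsᵛ-vmap h ys)

unsat-fwd : ∀ {T : Sequent k} {Es} (E : Eqn k) {e} →
  Unique (toList (args E)) → lhs E ∉ toList (args E) → Disjoint (toList (args E)) (allVars Es) →
  (∀ w → (w ∈L e) ⇔ (∃ λ ws → (ws ∈Lᵛ vmap (meet T) (args E)) × fun (fn E) ws ≡ w)) →
  Unsat T (E ∷ Es) → Unsat (T ++ [ lhs E ∈ʳ e ]) Es
unsat-fwd {T = T} {Es} E unique x∉ys disjoint image unsat ρ sat sats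
  with ws , ws∈ , f≡ ← to (image (ρ (lhs E))) (sat (∈-++⁺ʳ T (here refl))) =
  unsat ρ′ (RegSat-[≔] (args E) (sat ∘ ∈-++⁺ˡ) ws∈) (E-holds ∷ EqsSat-agree Es agree sats)
  where
  ρ′ : Var → Str _
  ρ′ = ρ [ args E ≔ ws ]

  E-holds : ρ′ (lhs E) ≡ fun (fn E) (vmap ρ′ (args E))
  E-holds = begin
    ρ′ (lhs E)                     ≡⟨ [≔]-∉ ρ (args E) ws x∉ys ⟩
    ρ (lhs E)                      ≡⟨ f≡ ⟨
    fun (fn E) ws                  ≡⟨ cong (fun (fn E)) ([≔]-vmap (args E) ws unique) ⟨
    fun (fn E) (vmap ρ′ (args E))  ∎
    where open ≡-Reasoning
  agree : ∀ {v} → v ∈ allVars Es → ρ v ≡ ρ′ v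
  agree v∈Es = sym ([≔]-∉ ρ (args E) ws (λ v∈ys → disjoint (v∈ys , v∈Es)))

unsat-bwd : ∀ {T : Sequent k} {Es} (E : Eqn k) {t} →
  lhs E ∉ toList (args E) → lhs E ∉ allVars Es →
  (∀ ws → ws ∈Lᵛ t → fun (fn E) ws ∈L meet T (lhs E)) →
  Unsat T (E ∷ Es) → Unsat (T ++ regsᵛ (args E) t) Es
unsat-bwd {T = T} {Es} E {t} x∉ys x∉Es preimage unsat ρ sat sats =
  unsat ρ′ (RegSat-[≔] (lhs E ∷ []) (sat ∘ ∈-++⁺ˡ) (preimage _ args∈t , tt))
        (E-holds ∷ EqsSat-agree Es agree sats)
  where
  value : Str _
  value = fun (fn E) (vmap ρ (args E))

  ρ′ : Var → Str _
  ρ′ = ρ [ lhs E ∷ [] ≔ value ∷ [] ]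

  args∈t : vmap ρ (args E) ∈Lᵛ t
  args∈t = regsᵛ-sat (args E) t (sat ∘ ∈-++⁺ʳ T)

  untouched : ∀ {v} → v ≢ lhs E → ρ v ≡ ρ′ v
  untouched {v} v≢x =
    sym ([≔]-∉ {v = v} ρ (lhs E ∷ []) (value ∷ []) λ { (here v≡x) → v≢x v≡x ; (there ()) })

  E-holds : ρ′ (lhs E) ≡ fun (fn E) (vmap ρ′ (args E))
  E-holds = begin
    ρ′ (lhs E)                     ≡⟨ cong vhead ([≔]-vmap (lhs E ∷ []) (value ∷ []) ([] ∷ [])) ⟩
    value                          ≡⟨ cong (fun (fn E)) args-untouched ⟩
    fun (fn E) (vmap ρ′ (args E))  ∎
    where
    open ≡-Reasoning
    args-untouched : vmap ρ (args E) ≡ vmap ρ′ (args E)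
    args-untouched = vmap-cong-∈ (args E) λ v∈ys → untouched λ { refl → x∉ys v∈ys }

  agree : ∀ {v} → v ∈ allVars Es → ρ v ≡ ρ′ v
  agree v∈Es = untouched λ { refl → x∉Es v∈Es }

choose : Regex k → Str k
choose e with nonempty? e
... | yes (w , _) = w
... | no _        = []

choose-∈ : ∀ {e : Regex k} → ¬ ¬ ∃ (_∈L e) → choose e ∈L e
choose-∈ {e = e} nonempty with nonempty? e
... | yes (_ , w∈e) = w∈e
... | no empty      = ⊥-elim (nonempty empty)

EmptyMeet : Sequent k → Constraint k → Set
EmptyMeet T (x ∈ʳ _) = ¬ ∃ (_∈L meet T x)
EmptyMeet T (eqn _)  = ⊥

emptyMeet? : ∀ (T : Sequent k) → Decidable (EmptyMeet T)
emptyMeet? T (x ∈ʳ _) = ¬? (nonempty? (meet T x))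
emptyMeet? T (eqn _)  = no id

regular-unsat⇒RCP : Unsat T [] → RCP T
regular-unsat⇒RCP {T = T} unsat with any? (emptyMeet? T) T
... | yes some with find some
...   | (x ∈ʳ _) , _ , empty =
  close′ x (regsOf T x) (regs-regsOf T x) (λ w ws → empty (w , from (∈L-⋂ _) ws))
...   | eqn _ , _ , ()
regular-unsat⇒RCP {T = T} unsat | no none = ⊥-elim (unsat witness sat [])
  where
  witness : Var → Str _
  witness x = choose (meet T x)
  sat : RegSat witness T
  sat c∈T = to ∈L-meet (choose-∈ (All.lookup (¬Any⇒All¬ T none) c∈T)) c∈T

Refutable : List (Eqn k) → Set
Refutable {k} Es = ∀ {T : Sequent k} → (∀ {E} → E ∈ Es → eqn E ∈ T) → Unsat T Es → RCP T

refutable-bwd : ∀ {E : Eqn k} {Es} → Backwardable (fun (fn E)) → occ (E ∷ Es) (lhs E) ≤ 1 →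
                Refutable Es → Refutable (E ∷ Es)
refutable-bwd {k} {E} {Es} B once refute {T} E∈T unsat =
  intersect-meet ⊆-refl (backward (B (meet T (lhs E))))
  where
  T₁ : Sequent k
  T₁ = T ++ [ lhs E ∈ʳ meet T (lhs E) ]

  E∈T₁ : eqn E ∈ T₁
  E∈T₁ = ∈-++⁺ˡ (E∈T (here refl))

  x∈T₁ : (lhs E ∈ʳ meet T (lhs E)) ∈ T₁
  x∈T₁ = ∈-++⁺ʳ T (here refl)

  Preimage : List (Vec (Regex k) (arity (fn E))) → Set
  Preimage ts = ∀ ws → (fun (fn E) ws ∈L meet T (lhs E)) ⇔ Any (ws ∈Lᵛ_) ts

  branch : ∀ {ts} → Preimage ts → ∀ {t} → t ∈ ts → RCP (T₁ ++ regsᵛ (args E) t)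
  branch preimage t∈ts =
    refute (∈-++⁺ˡ ∘ ∈-++⁺ˡ ∘ E∈T ∘ there)
      (Unsat-mono (++⁺ (xs⊆xs++ys T _) ⊆-refl)
        (unsat-bwd E (lhs-once⇒∉args E Es once) (lhs-once⇒∉later E Es once)
                   (λ ws ws∈t → from (preimage ws) (lose t∈ts ws∈t)) unsat))

  backward : Σ _ Preimage → RCP T₁
  backward ([]     , preimage) =
    refute-empty-preimage E _ E∈T₁ x∈T₁ (λ ws → Anyₚ.¬Any[] ∘ to (preimage ws))
  backward (t ∷ ts , preimage) =
    bwd-prop′ E _ t ts E∈T₁ x∈T₁ preimage (All.tabulate (branch preimage))

refutable-fwd : ∀ {E : Eqn k} {Es} → Forwardable (fun (fn E)) →
                All (λ y → occ (E ∷ Es) y ≤ 1) (toList (args E)) →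
                Refutable Es → Refutable (E ∷ Es)
refutable-fwd {E = E} {Es} F once refute {T} E∈T unsat
  with e , image ← F (vmap (meet T) (args E)) =
  intersect-meets (toList (args E)) ⊆-refl
    (fwd-prop′ E _ e (∈-++⁺ˡ (E∈T (here refl))) args⊆ image
      (refute (∈-++⁺ˡ ∘ ∈-++⁺ˡ ∘ E∈T ∘ there)
        (Unsat-mono (++⁺ (xs⊆xs++ys T _) ⊆-refl)
          (unsat-fwd E (args-once⇒Unique E Es once) (args-once⇒lhs∉args E Es once)
                     (args-once⇒Disjoint E Es once) image unsat))))
  where
  args⊆ : regsᵛ (args E) (vmap (meet T) (args E)) ⊆ T ++ map (λ y → y ∈ʳ meet T y) (toList (args E))
  args⊆ = ∈-++⁺ʳ T ∘ ⊆-reflexive (regsᵛ-vmap (meet T) (args E))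

admissible⇒refutable : ∀ {fl : Flow k} → Admissible fl → Refutable (eqs fl)
admissible⇒refutable []               _ = regular-unsat⇒RCP
admissible⇒refutable (bwd B once adm) = refutable-bwd B once (admissible⇒refutable adm)
admissible⇒refutable (fwd F once adm) = refutable-fwd F once (admissible⇒refutable adm)

sat-sequent : ∀ (S : Sequent k) {ρ} → RegSat ρ S → EqsSat ρ (eqsOf S) → All (Sat ρ) S
sat-sequent []             _   _             = []
sat-sequent ((x ∈ʳ e) ∷ S) sat sats          = sat (here refl) ∷ sat-sequent S (sat ∘ there) sats
sat-sequent (eqn E ∷ S)    sat (satE ∷ sats) = satE ∷ sat-sequent S (sat ∘ there) sats

eqsOf-sound : ∀ (S : Sequent k) {E} → E ∈ eqsOf S → eqn E ∈ S
eqsOf-sound ((x ∈ʳ e) ∷ S) m           = there (eqsOf-sound S m)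
eqsOf-sound (eqn E ∷ S)    (here refl) = here refl
eqsOf-sound (eqn E ∷ S)    (there m)   = there (eqsOf-sound S m)

corollary1 : (k : ℕ) (S : Sequent k) → Unique S → ¬ Satisfiable S → Orderable S → RCP S
corollary1 k S _ unsat orderable with fl , adm , fl↭S ← orderable⇒admissible S orderable =
  admissible⇒refutable adm (eqsOf-sound S ∘ ↭.∈-resp-↭ fl↭S)
    (λ ρ sat sats → unsat (ρ , sat-sequent S sat (↭.All-resp-↭ fl↭S sats)))
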